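{- For every integer $n \ge 1$, let $f(n)$ be the maximum, over all cyclic permutations $\pi$ of order $n$, of the minimum number of adjacent swaps needed to transform $\pi$ into the trivial cyclic permutation $u=(1,2,\ldots,n)$. Then \[ f(n) \ge \left\lfloor \frac{(n-1)^2}{4} \right\rfloor. \]
   Context: A cyclic permutation of order $n$ is a bijective labeling of the vertices of a cycle of length $n$ by the elements of $[n]=\{1,\ldots,n\}$, where two labelings that differ by a rotation of the cycle (a cyclic shift) are considered the same; reflections are not identified. An adjacent swap transforms a cyclic permutation into the one obtained by exchanging the labels of two vertices that are adjacent along the cycle. The trivial cyclic permutation $u=(1,2,\ldots,n)$ is the labeling in which the labels $1,2,\ldots,n$ appear consecutively around the cycle in this order. -}

module Defs where

open import Data.Nat using (ℕ; zero; suc; _<?_)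
open import Data.Fin using (Fin; toℕ; fromℕ<; zero)
open import Data.Vec using (Vec; lookup; tabulate; allFin; _[_]≔_)
open import Data.List using (List; []; _∷_)
open import Data.Product using (∃; _×_)
open import Relation.Nullary using (yes; no)
open import Relation.Binary.PropositionalEquality using (_≡_)

-- A labeling of the n-cycle: position p (vertices 0..n-1 in cyclic order)
-- carries label  lookup v p  ; label (i : Fin n) stands for i+1 ∈ [n].
Labeling : ℕ → Set
Labeling n = Vec (Fin n) n

IsBijective : ∀ {n} → Labeling n → Set
IsBijective {n} v =
  (∀ (p q : Fin n) → lookup v p ≡ lookup v q → p ≡ q) ×
  (∀ (j : Fin n) → ∃ λ p → lookup v p ≡ j)

cycSucc : ∀ {n} → Fin n → Fin n
cycSucc {suc m} p with suc (toℕ p) <? suc m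
... | yes lt = fromℕ< lt
... | no _ = zero

cycSuccIter : ∀ {n} → ℕ → Fin n → Fin n
cycSuccIter zero p = p
cycSuccIter (suc k) p = cycSucc (cycSuccIter k p)

rotate : ∀ {n} → ℕ → Labeling n → Labeling n
rotate k v = tabulate (λ p → lookup v (cycSuccIter k p))

adjSwap : ∀ {n} → Fin n → Labeling n → Labeling n
adjSwap p v = (v [ p ]≔ lookup v q) [ q ]≔ lookup v p
  where q = cycSucc p

applySwaps : ∀ {n} → List (Fin n) → Labeling n → Labeling n
applySwaps [] v = v
applySwaps (p ∷ ps) v = applySwaps ps (adjSwap p v)

trivial : ∀ n → Labeling n
trivial n = allFin n

IsTrivialCyclic : ∀ {n} → Labeling n → Set
IsTrivialCyclic {n} v = ∃ λ k → v ≡ rotate k (trivial n)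

-- Unroll the cycle at the seam between its last and first vertex and let every label
-- travel as a token carrying the parity of the number of times it has crossed the seam.
-- A pair of tokens is a twisted inversion when its labels are inverted xor its parities
-- differ. A crossing moves a token to the other end of the row and flips its parity, which
-- leaves its relation to all other tokens unchanged; hence every adjacent swap, across the
-- seam or not, changes the number of twisted inversions by at most one. The reversal of
-- (1, …, n) has n(n − 1)/2 twisted inversions. At a rotation of (1, …, n) a pair is twisted
-- exactly when the bits "parity xor not yet wrapped around" differ, so there are at most
-- n²/4. Hence at least n(n − 1)/2 − n²/4 = ((n − 1)² − 1)/4 swaps are needed.

{-# OPTIONS --safe #-}
module Submission where

open import Defs
open import Data.Nat using (ℕ; suc; _*_; _/_; _≤_)
open import Data.Fin using (Fin)
open import Data.List using (List; length)
open import Data.Product using (∃; _×_)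

open import Level using (Level)
open import Function using (id; _∘_)
open import Function.Definitions using (Injective)
open import Algebra.Bundles using (CommutativeRing)
open import Data.Bool using (Bool; true; false; not; _xor_; if_then_else_)
open import Data.Bool.Properties
  using (not-involutive; not-distribˡ-xor; xor-comm; xor-annihilates-not; xor-∧-commutativeRing)
open import Data.Nat using (zero; _+_; _∸_; _<_; _<?_; _%_; z≤n; s≤s; z<s; s<s; NonZero)
open import Data.Nat.Properties
  using (≤-refl; ≤-trans; ≤-antisym; ≤-total; ≤-<-trans; <-trans; <-cmp; <⇒≯; ≮⇒≥;
         n≤1+n; m≤m+n; m<m+n; m<1+n⇒m≤n; m≤n⇒∃[o]m+o≡n; m∸n+n≡m; m<n+o⇒m∸n<o;
         +-comm; +-suc; *-comm; *-suc; *-distribˡ-+;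
         +-monoˡ-≤; +-monoʳ-≤; +-monoʳ-<; +-mono-<; *-monoʳ-≤; ∸-monoˡ-<; ∸-monoʳ-<;
         +-cancelʳ-≤; +-cancelʳ-<; +-commutativeSemigroup; module ≤-Reasoning)
open import Data.Nat.DivMod
  using (%-distribˡ-+; m%n%n≡m%n; m%n<n; n%n≡0; m<n⇒m%n≡m; m≤n⇒[n∸m]%m≡n%m; m<n*o⇒m/o<n)
open import Data.Nat.Tactic.RingSolver using (solve-∀)
open import Data.Fin as Fin using (zero; suc; toℕ; fromℕ; inject₁; opposite)
open import Data.Fin.Properties
  using (toℕ-injective; toℕ-inject₁; toℕ-fromℕ; toℕ-fromℕ<; toℕ<n; fromℕ≢inject₁;
         opposite-prop; opposite-involutive)
import Data.Fin.Properties as Finₚ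
open import Data.Fin.Permutation.Components using (transpose; transpose-inverse)
open import Data.Fin.Relation.Unary.Top using (view; ‵fromℕ; ‵inject₁)
open import Data.List using ([]; _∷_)
open import Data.Product as Product using (_,_; proj₁; proj₂; map₂)
open import Data.Sum using ([_,_]′)
open import Data.Vec using (Vec; []; _∷_; lookup; tabulate; map; _[_]≔_; _∷ʳ_; initLast; countᵇ)
open import Data.Vec.Properties
  using (map-[]≔; map-∷ʳ; map-∘; map-id; lookup-map; lookup∘update; lookup∘update′;
         lookup∘tabulate; lookup-allFin)
open import Relation.Binary.Definitions using (tri<; tri≈; tri>)
open import Relation.Binary.PropositionalEquality
open import Relation.Nullary using (Dec; yes; no; does; contradiction)
open import Relation.Nullary.Decidable using (dec-true; dec-false)
open import Algebra.Properties.CommutativeSemigroup +-commutativeSemigroup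
  using (x∙yz≈y∙xz)
open import Algebra.Properties.CommutativeSemigroup
  (CommutativeRing.+-commutativeSemigroup xor-∧-commutativeRing)
  using () renaming (interchange to xor-interchange)

private
  variable
    a : Level
    A B : Set a
    k m n : ℕ

sucIf : Bool → ℕ → ℕ
sucIf b = if b then suc else id

sucIf-comm : ∀ b c n → sucIf b (sucIf c n) ≡ sucIf c (sucIf b n)
sucIf-comm true  true  _ = refl
sucIf-comm true  false _ = refl
sucIf-comm false _     _ = refl

n≤sucIf : ∀ b n → n ≤ sucIf b n
n≤sucIf true  n = n≤1+n n
n≤sucIf false n = ≤-refl

sucIf≤suc : ∀ b n → sucIf b n ≤ suc n
sucIf≤suc true  n = ≤-refl
sucIf≤suc false n = n≤1+n n

sucIf-interchange : ∀ b x y z → sucIf b x + (y + z) ≡ sucIf b y + (x + z)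
sucIf-interchange true  x y z = cong suc (x∙yz≈y∙xz x y z)
sucIf-interchange false x y z = x∙yz≈y∙xz x y z

sucIf-exchange-≤ : ∀ b c x y z → sucIf b x + (y + z) ≤ suc (sucIf c y + (x + z))
sucIf-exchange-≤ b c x y z = begin
  sucIf b x + (y + z)     ≤⟨ +-monoˡ-≤ (y + z) (sucIf≤suc b x) ⟩
  suc (x + (y + z))       ≡⟨ cong suc (x∙yz≈y∙xz x y z) ⟩
  suc (y + (x + z))       ≤⟨ s≤s (+-monoˡ-≤ (x + z) (n≤sucIf c y)) ⟩
  suc (sucIf c y + (x + z)) ∎
  where open ≤-Reasoning

swapAdjacent : Fin k → Vec A (suc k) → Vec A (suc k)
swapAdjacent zero    (x ∷ y ∷ xs) = y ∷ x ∷ xs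
swapAdjacent (suc i) (x ∷ xs)     = x ∷ swapAdjacent i xs

countᵇ-cong : ∀ {p : A → Bool} {q : B → Bool} (xs : Vec A k) (ys : Vec B k) →
              (∀ i → p (lookup xs i) ≡ q (lookup ys i)) → countᵇ p xs ≡ countᵇ q ys
countᵇ-cong []       []       _  = refl
countᵇ-cong (x ∷ xs) (y ∷ ys) eq = cong₂ sucIf (eq zero) (countᵇ-cong xs ys (eq ∘ suc))

countᵇ-∷ʳ : ∀ (p : A → Bool) (xs : Vec A k) y → countᵇ p (xs ∷ʳ y) ≡ sucIf (p y) (countᵇ p xs)
countᵇ-∷ʳ p []       y = refl
countᵇ-∷ʳ p (x ∷ xs) y =
  trans (cong (sucIf (p x)) (countᵇ-∷ʳ p xs y)) (sucIf-comm (p x) (p y) _)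

countᵇ-swapAdjacent : ∀ (p : A → Bool) (i : Fin k) xs → countᵇ p (swapAdjacent i xs) ≡ countᵇ p xs
countᵇ-swapAdjacent p zero    (x ∷ y ∷ xs) = sucIf-comm (p y) (p x) _
countᵇ-swapAdjacent p (suc i) (x ∷ xs)     = cong (sucIf (p x)) (countᵇ-swapAdjacent p i xs)

countᵇ-true : (xs : Vec A k) → countᵇ (λ _ → true) xs ≡ k
countᵇ-true []       = refl
countᵇ-true (x ∷ xs) = cong suc (countᵇ-true xs)

countᵇ-id+not : (bs : Vec Bool k) → countᵇ id bs + countᵇ not bs ≡ k
countᵇ-id+not []           = refl
countᵇ-id+not (true  ∷ bs) = cong suc (countᵇ-id+not bs)
countᵇ-id+not (false ∷ bs) =
  trans (+-suc (countᵇ id bs) (countᵇ not bs)) (cong suc (countᵇ-id+not bs))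

countPairsᵇ : (A → A → Bool) → Vec A k → ℕ
countPairsᵇ R []       = 0
countPairsᵇ R (x ∷ xs) = countᵇ (R x) xs + countPairsᵇ R xs

countPairsᵇ-cong : ∀ {R : A → A → Bool} {S : B → B → Bool} (xs : Vec A k) (ys : Vec B k) →
                   (∀ {i j} → i Fin.< j → R (lookup xs i) (lookup xs j) ≡ S (lookup ys i) (lookup ys j)) →
                   countPairsᵇ R xs ≡ countPairsᵇ S ys
countPairsᵇ-cong []       []       _  = refl
countPairsᵇ-cong (x ∷ xs) (y ∷ ys) eq = cong₂ _+_
  (countᵇ-cong xs ys (λ j → eq {zero} {suc j} z<s))
  (countPairsᵇ-cong xs ys (λ i<j → eq (s<s i<j)))

countPairsᵇ-∷ʳ : ∀ (R : A → A → Bool) (xs : Vec A k) y →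
                 countPairsᵇ R (xs ∷ʳ y) ≡ countᵇ (λ x → R x y) xs + countPairsᵇ R xs
countPairsᵇ-∷ʳ R []       y = refl
countPairsᵇ-∷ʳ R (x ∷ xs) y = begin
  countᵇ (R x) (xs ∷ʳ y) + countPairsᵇ R (xs ∷ʳ y)
    ≡⟨ cong₂ _+_ (countᵇ-∷ʳ (R x) xs y) (countPairsᵇ-∷ʳ R xs y) ⟩
  sucIf (R x y) (countᵇ (R x) xs) + (countᵇ (λ z → R z y) xs + countPairsᵇ R xs)
    ≡⟨ sucIf-interchange (R x y) _ _ _ ⟩
  sucIf (R x y) (countᵇ (λ z → R z y) xs) + (countᵇ (R x) xs + countPairsᵇ R xs) ∎
  where open ≡-Reasoning

countPairsᵇ-swapAdjacent : ∀ (R : A → A → Bool) (i : Fin k) xs →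
                           countPairsᵇ R xs ≤ suc (countPairsᵇ R (swapAdjacent i xs))
countPairsᵇ-swapAdjacent R zero    (x ∷ y ∷ xs) = sucIf-exchange-≤ (R x y) (R y x) _ _ _
countPairsᵇ-swapAdjacent R (suc i) (x ∷ xs)     = begin
  countᵇ (R x) xs + countPairsᵇ R xs
    ≤⟨ +-monoʳ-≤ (countᵇ (R x) xs) (countPairsᵇ-swapAdjacent R i xs) ⟩
  countᵇ (R x) xs + suc (countPairsᵇ R (swapAdjacent i xs))
    ≡⟨ +-suc _ _ ⟩
  suc (countᵇ (R x) xs + countPairsᵇ R (swapAdjacent i xs))
    ≡⟨ cong (λ c → suc (c + countPairsᵇ R (swapAdjacent i xs))) (countᵇ-swapAdjacent (R x) i xs) ⟨
  suc (countᵇ (R x) (swapAdjacent i xs) + countPairsᵇ R (swapAdjacent i xs)) ∎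
  where open ≤-Reasoning

countPairsᵇ-true : (xs : Vec A k) → 2 * countPairsᵇ (λ _ _ → true) xs + k ≡ k * k
countPairsᵇ-true []                 = refl
countPairsᵇ-true {k = suc k} (x ∷ xs) = begin
  2 * (countᵇ (λ _ → true) xs + P) + suc k ≡⟨ cong (λ c → 2 * (c + P) + suc k) (countᵇ-true xs) ⟩
  2 * (k + P) + suc k                       ≡⟨ expand k P ⟩
  (2 * P + k) + (2 * k + 1)                 ≡⟨ cong (_+ (2 * k + 1)) (countPairsᵇ-true xs) ⟩
  k * k + (2 * k + 1)                       ≡⟨ square k ⟩
  suc k * suc k                             ∎
  where
  open ≡-Reasoning
  P = countPairsᵇ (λ _ _ → true) xs
  expand : ∀ k P → 2 * (k + P) + suc k ≡ (2 * P + k) + (2 * k + 1)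
  expand = solve-∀
  square : ∀ k → k * k + (2 * k + 1) ≡ suc k * suc k
  square = solve-∀

countPairsᵇ-xor : (bs : Vec Bool k) → countPairsᵇ _xor_ bs ≡ countᵇ id bs * countᵇ not bs
countPairsᵇ-xor []           = refl
countPairsᵇ-xor (true  ∷ bs) = cong (countᵇ not bs +_) (countPairsᵇ-xor bs)
countPairsᵇ-xor (false ∷ bs) =
  trans (cong (countᵇ id bs +_) (countPairsᵇ-xor bs)) (sym (*-suc (countᵇ id bs) (countᵇ not bs)))

4xy≤[x+y]² : ∀ x y → 4 * (x * y) ≤ (x + y) * (x + y)
4xy≤[x+y]² x y = [ ordered , reversed ]′ (≤-total x y)
  where
  ordered : ∀ {x y} → x ≤ y → 4 * (x * y) ≤ (x + y) * (x + y)
  ordered {x} x≤y with d , refl ← m≤n⇒∃[o]m+o≡n x≤y = begin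
    4 * (x * (x + d))                ≤⟨ m≤m+n _ (d * d) ⟩
    4 * (x * (x + d)) + d * d        ≡⟨ square x d ⟩
    (x + (x + d)) * (x + (x + d))    ∎
    where
    open ≤-Reasoning
    square : ∀ x d → 4 * (x * (x + d)) + d * d ≡ (x + (x + d)) * (x + (x + d))
    square = solve-∀
  reversed : y ≤ x → 4 * (x * y) ≤ (x + y) * (x + y)
  reversed y≤x = subst₂ _≤_ (cong (4 *_) (*-comm y x)) (cong (λ s → s * s) (+-comm y x)) (ordered y≤x)

-- adjSwap p is swapWith id p by definition.
swapWith : (A → A) → Fin n → Vec A n → Vec A n
swapWith g p xs = (xs [ p ]≔ g (lookup xs q)) [ q ]≔ g (lookup xs p)
  where q = cycSucc p

lookup-exchange : ∀ (xs : Vec A n) i j k →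
                  lookup ((xs [ i ]≔ lookup xs j) [ j ]≔ lookup xs i) k ≡ lookup xs (transpose j i k)
lookup-exchange xs i j k with k Fin.≟ j
... | yes refl = lookup∘update k (xs [ i ]≔ lookup xs k) (lookup xs i)
... | no k≢j with k Fin.≟ i
...   | yes refl = trans (lookup∘update′ k≢j (xs [ k ]≔ lookup xs j) (lookup xs k))
                         (lookup∘update k xs (lookup xs j))
...   | no k≢i   = trans (lookup∘update′ k≢j (xs [ i ]≔ lookup xs j) (lookup xs i))
                         (lookup∘update′ k≢i xs (lookup xs j))

swapWith-injective : ∀ (p : Fin n) (xs : Vec A n) →
                     Injective _≡_ _≡_ (lookup xs) → Injective _≡_ _≡_ (lookup (swapWith id p xs))
swapWith-injective p xs inj {r} {r′} eq = begin
  r                                ≡⟨ transpose-inverse p q ⟨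
  transpose p q (transpose q p r)  ≡⟨ cong (transpose p q) (inj (begin
    lookup xs (transpose q p r)      ≡⟨ lookup-exchange xs p q r ⟨
    lookup (swapWith id p xs) r      ≡⟨ eq ⟩
    lookup (swapWith id p xs) r′     ≡⟨ lookup-exchange xs p q r′ ⟩
    lookup xs (transpose q p r′)     ∎)) ⟩
  transpose p q (transpose q p r′) ≡⟨ transpose-inverse p q ⟩
  r′                               ∎
  where
  open ≡-Reasoning
  q = cycSucc p

map-swapWith : ∀ (f : A → B) (g : A → A) (p : Fin n) (xs : Vec A n) →
               (∀ x → f (g x) ≡ f x) → map f (swapWith g p xs) ≡ swapWith id p (map f xs)
map-swapWith f g p xs fg≡f = begin
  map f ((xs [ p ]≔ g (lookup xs q)) [ q ]≔ g (lookup xs p))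
    ≡⟨ map-[]≔ f (xs [ p ]≔ g (lookup xs q)) q ⟩
  map f (xs [ p ]≔ g (lookup xs q)) [ q ]≔ f (g (lookup xs p))
    ≡⟨ cong (_[ q ]≔ f (g (lookup xs p))) (map-[]≔ f xs p) ⟩
  (map f xs [ p ]≔ f (g (lookup xs q))) [ q ]≔ f (g (lookup xs p))
    ≡⟨ cong₂ (λ u v → (map f xs [ p ]≔ u) [ q ]≔ v) (f-lookup q) (f-lookup p) ⟩
  (map f xs [ p ]≔ lookup (map f xs) q) [ q ]≔ lookup (map f xs) p ∎
  where
  open ≡-Reasoning
  q = cycSucc p
  f-lookup : ∀ r → f (g (lookup xs r)) ≡ lookup (map f xs) r
  f-lookup r = trans (fg≡f (lookup xs r)) (sym (lookup-map r f xs))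

lookup-∷ʳ-fromℕ : ∀ (xs : Vec A k) y → lookup (xs ∷ʳ y) (fromℕ k) ≡ y
lookup-∷ʳ-fromℕ []       y = refl
lookup-∷ʳ-fromℕ (x ∷ xs) y = lookup-∷ʳ-fromℕ xs y

lookup-∷ʳ-inject₁ : ∀ (xs : Vec A k) y i → lookup (xs ∷ʳ y) (inject₁ i) ≡ lookup xs i
lookup-∷ʳ-inject₁ (x ∷ xs) y zero    = refl
lookup-∷ʳ-inject₁ (x ∷ xs) y (suc i) = lookup-∷ʳ-inject₁ xs y i

∷ʳ-[]≔-fromℕ : ∀ (xs : Vec A k) y z → (xs ∷ʳ y) [ fromℕ k ]≔ z ≡ xs ∷ʳ z
∷ʳ-[]≔-fromℕ []       y z = refl
∷ʳ-[]≔-fromℕ (x ∷ xs) y z = cong (x ∷_) (∷ʳ-[]≔-fromℕ xs y z)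

inner≢ends : ∀ {x y} (xs : Vec A k) → Injective _≡_ _≡_ (lookup (x ∷ (xs ∷ʳ y))) →
             ∀ i → lookup xs i ≢ x × lookup xs i ≢ y
inner≢ends {x = x} {y} xs inj i =
    (λ xsᵢ≡x → Finₚ.0≢1+n (sym (inj (trans (lookup-∷ʳ-inject₁ xs y i) xsᵢ≡x))))
  , (λ xsᵢ≡y → fromℕ≢inject₁ (sym (Finₚ.suc-injective (inj
      (trans (lookup-∷ʳ-inject₁ xs y i) (trans xsᵢ≡y (sym (lookup-∷ʳ-fromℕ xs y))))))))

[m+n%d]%d≡[m+n]%d : ∀ m n d .{{_ : NonZero d}} → (m + n % d) % d ≡ (m + n) % d
[m+n%d]%d≡[m+n]%d m n d = begin
  (m + n % d) % d            ≡⟨ %-distribˡ-+ m (n % d) d ⟩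
  (m % d + n % d % d) % d    ≡⟨ cong (λ t → (m % d + t) % d) (m%n%n≡m%n n d) ⟩
  (m % d + n % d) % d        ≡⟨ %-distribˡ-+ m n d ⟨
  (m + n) % d                ∎
  where open ≡-Reasoning

[m%d+n]%d≡[m+n]%d : ∀ m n d .{{_ : NonZero d}} → (m % d + n) % d ≡ (m + n) % d
[m%d+n]%d≡[m+n]%d m n d = begin
  (m % d + n) % d  ≡⟨ cong (_% d) (+-comm (m % d) n) ⟩
  (n + m % d) % d  ≡⟨ [m+n%d]%d≡[m+n]%d n m d ⟩
  (n + m) % d      ≡⟨ cong (_% d) (+-comm n m) ⟩
  (m + n) % d      ∎
  where open ≡-Reasoning

toℕ-cycSucc : (p : Fin (suc m)) → toℕ (cycSucc p) ≡ suc (toℕ p) % suc m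
toℕ-cycSucc {m} p with suc (toℕ p) <? suc m
... | yes p+1<n = trans (toℕ-fromℕ< p+1<n) (sym (m<n⇒m%n≡m p+1<n))
... | no  p+1≮n = sym (trans (cong (_% suc m) p+1≡n) (n%n≡0 (suc m)))
  where
  p+1≡n : suc (toℕ p) ≡ suc m
  p+1≡n = ≤-antisym (toℕ<n p) (≮⇒≥ p+1≮n)

cycSucc-inject₁ : (i : Fin m) → cycSucc (inject₁ i) ≡ suc i
cycSucc-inject₁ {m} i = toℕ-injective (begin
  toℕ (cycSucc (inject₁ i))        ≡⟨ toℕ-cycSucc (inject₁ i) ⟩
  suc (toℕ (inject₁ i)) % suc m    ≡⟨ cong (λ t → suc t % suc m) (toℕ-inject₁ i) ⟩
  suc (toℕ i) % suc m              ≡⟨ m<n⇒m%n≡m (s<s (toℕ<n i)) ⟩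
  suc (toℕ i)                      ∎)
  where open ≡-Reasoning

cycSucc-fromℕ : ∀ m → cycSucc (fromℕ m) ≡ zero
cycSucc-fromℕ m = toℕ-injective (begin
  toℕ (cycSucc (fromℕ m))        ≡⟨ toℕ-cycSucc (fromℕ m) ⟩
  suc (toℕ (fromℕ m)) % suc m    ≡⟨ cong (λ t → suc t % suc m) (toℕ-fromℕ m) ⟩
  suc m % suc m                  ≡⟨ n%n≡0 (suc m) ⟩
  0                              ∎)
  where open ≡-Reasoning

exchange-inject₁-suc : ∀ (i : Fin k) (xs : Vec A (suc k)) →
                       (xs [ inject₁ i ]≔ lookup xs (suc i)) [ suc i ]≔ lookup xs (inject₁ i) ≡ swapAdjacent i xs
exchange-inject₁-suc zero    (x ∷ y ∷ xs) = refl
exchange-inject₁-suc (suc i) (x ∷ xs)     = cong (x ∷_) (exchange-inject₁-suc i xs)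

swapWith-inject₁ : ∀ (i : Fin m) (xs : Vec A (suc m)) → swapWith id (inject₁ i) xs ≡ swapAdjacent i xs
swapWith-inject₁ i xs rewrite cycSucc-inject₁ i = exchange-inject₁-suc i xs

swapWith-fromℕ : ∀ (g : A → A) x y (xs : Vec A k) →
                 swapWith g (fromℕ (suc k)) (x ∷ (xs ∷ʳ y)) ≡ g y ∷ (xs ∷ʳ g x)
swapWith-fromℕ {k = k} g x y xs
  rewrite cycSucc-fromℕ (suc k) | lookup-∷ʳ-fromℕ xs y | ∷ʳ-[]≔-fromℕ xs y (g x) = refl

toℕ-cycSuccIter : ∀ j (p : Fin (suc m)) → toℕ (cycSuccIter j p) ≡ (j + toℕ p) % suc m
toℕ-cycSuccIter     zero    p = sym (m<n⇒m%n≡m (toℕ<n p))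
toℕ-cycSuccIter {m} (suc j) p = begin
  toℕ (cycSucc (cycSuccIter j p))      ≡⟨ toℕ-cycSucc (cycSuccIter j p) ⟩
  suc (toℕ (cycSuccIter j p)) % suc m  ≡⟨ cong (λ t → suc t % suc m) (toℕ-cycSuccIter j p) ⟩
  (1 + (j + toℕ p) % suc m) % suc m    ≡⟨ [m+n%d]%d≡[m+n]%d 1 (j + toℕ p) (suc m) ⟩
  suc (j + toℕ p) % suc m              ∎
  where open ≡-Reasoning

toℕ-lookup-rotate-trivial : ∀ j (p : Fin (suc m)) →
  toℕ (lookup (rotate j (trivial (suc m))) p) ≡ (j % suc m + toℕ p) % suc m
toℕ-lookup-rotate-trivial {m} j p = begin
  toℕ (lookup (rotate j (trivial (suc m))) p)
    ≡⟨ cong toℕ (lookup∘tabulate (lookup (trivial (suc m)) ∘ cycSuccIter j) p) ⟩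
  toℕ (lookup (trivial (suc m)) (cycSuccIter j p))
    ≡⟨ cong toℕ (lookup-allFin (cycSuccIter j p)) ⟩
  toℕ (cycSuccIter j p)
    ≡⟨ toℕ-cycSuccIter j p ⟩
  (j + toℕ p) % suc m
    ≡⟨ [m%d+n]%d≡[m+n]%d j (toℕ p) (suc m) ⟨
  (j % suc m + toℕ p) % suc m ∎
  where open ≡-Reasoning

Token : ℕ → Set
Token n = Fin n × Bool

label : Token n → Fin n
label = proj₁

parity : Token n → Bool
parity = proj₂

labels : Vec (Token n) k → Vec (Fin n) k
labels = map label

flipParity : Token n → Token n
flipParity = map₂ not

flipParity-involutive : (x : Token n) → flipParity (flipParity x) ≡ x
flipParity-involutive x = cong (label x ,_) (not-involutive (parity x))

-- x is the token placed before y.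
twisted : Token n → Token n → Bool
twisted x y = (parity x xor parity y) xor does (toℕ (label y) <? toℕ (label x))

twistedInversions : Vec (Token n) k → ℕ
twistedInversions = countPairsᵇ twisted

does-<?-flip : ∀ {i j} → i ≢ j → does (j <? i) ≡ not (does (i <? j))
does-<?-flip {i} {j} i≢j with <-cmp i j
... | tri< i<j _ _ = trans (dec-false (j <? i) (<⇒≯ i<j)) (cong not (sym (dec-true (i <? j) i<j)))
... | tri≈ _ i≡j _ = contradiction i≡j i≢j
... | tri> _ _ j<i = trans (dec-true (j <? i) j<i) (cong not (sym (dec-false (i <? j) (<⇒≯ j<i))))

twisted-flipParityˡ : ∀ (x y : Token n) → label x ≢ label y → twisted (flipParity x) y ≡ twisted y x
twisted-flipParityˡ x y lx≢ly = begin
  (not s xor t) xor does (toℕ (label y) <? toℕ (label x))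
    ≡⟨ cong ((not s xor t) xor_) (does-<?-flip (lx≢ly ∘ toℕ-injective)) ⟩
  (not s xor t) xor not b  ≡⟨ cong (_xor not b) (not-distribˡ-xor s t) ⟨
  not (s xor t) xor not b  ≡⟨ xor-annihilates-not (s xor t) b ⟩
  (s xor t) xor b          ≡⟨ cong (_xor b) (xor-comm s t) ⟩
  (t xor s) xor b          ∎
  where
  open ≡-Reasoning
  s = parity x
  t = parity y
  b = does (toℕ (label x) <? toℕ (label y))

twisted-flipParityʳ : ∀ (x y : Token n) → label x ≢ label y → twisted y (flipParity x) ≡ twisted x y
twisted-flipParityʳ x y lx≢ly = begin
  twisted y (flipParity x)                ≡⟨ twisted-flipParityˡ (flipParity x) y lx≢ly ⟨
  twisted (flipParity (flipParity x)) y   ≡⟨ cong (λ z → twisted z y) (flipParity-involutive x) ⟩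
  twisted x y                             ∎
  where open ≡-Reasoning

-- x̃ at the end relates to every inner token as x did at the front, and likewise ỹ at the
-- front as y did at the end, so only the pair x, y itself can change.
twistedInversions-seam : ∀ (x y : Token n) (xs : Vec (Token n) k) →
  (∀ i → label (lookup xs i) ≢ label x) → (∀ i → label (lookup xs i) ≢ label y) →
  twistedInversions (x ∷ (xs ∷ʳ y)) ≤ suc (twistedInversions (flipParity y ∷ (xs ∷ʳ flipParity x)))
twistedInversions-seam x y xs x∉xs y∉xs = begin
  countᵇ (twisted x) (xs ∷ʳ y) + twistedInversions (xs ∷ʳ y)
    ≡⟨ cong₂ _+_ (countᵇ-∷ʳ (twisted x) xs y) (countPairsᵇ-∷ʳ twisted xs y) ⟩
  sucIf (twisted x y) withX + (withY + twistedInversions xs)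
    ≤⟨ sucIf-exchange-≤ (twisted x y) (twisted ỹ x̃) withX withY _ ⟩
  suc (sucIf (twisted ỹ x̃) withY + (withX + twistedInversions xs))
    ≡⟨ cong suc (cong₂ _+_ withỸ withX̃) ⟩
  suc (countᵇ (twisted ỹ) (xs ∷ʳ x̃) + twistedInversions (xs ∷ʳ x̃)) ∎
  where
  open ≤-Reasoning
  x̃ = flipParity x
  ỹ = flipParity y
  withX = countᵇ (twisted x) xs
  withY = countᵇ (λ z → twisted z y) xs
  withỸ : sucIf (twisted ỹ x̃) withY ≡ countᵇ (twisted ỹ) (xs ∷ʳ x̃)
  withỸ = trans (cong (sucIf (twisted ỹ x̃))
                  (countᵇ-cong xs xs (λ i → sym (twisted-flipParityˡ y _ (≢-sym (y∉xs i))))))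
                (sym (countᵇ-∷ʳ (twisted ỹ) xs x̃))
  withX̃ : withX + twistedInversions xs ≡ twistedInversions (xs ∷ʳ x̃)
  withX̃ = trans (cong (_+ twistedInversions xs)
                  (countᵇ-cong xs xs (λ i → sym (twisted-flipParityʳ x _ (≢-sym (x∉xs i))))))
                (sym (countPairsᵇ-∷ʳ twisted xs x̃))

twistedInversions-seamSwap : ∀ (W : Vec (Token n) (suc m)) → Injective _≡_ _≡_ (lookup (labels W)) →
  twistedInversions W ≤ suc (twistedInversions (swapWith flipParity (fromℕ m) W))
twistedInversions-seamSwap {m = zero}  (x ∷ []) _   = z≤n
twistedInversions-seamSwap {m = suc k} (x ∷ V)  inj with initLast V
... | xs , y , refl = subst (λ V → twistedInversions (x ∷ (xs ∷ʳ y)) ≤ suc (twistedInversions V))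
  (sym (swapWith-fromℕ flipParity x y xs))
  (twistedInversions-seam x y xs (proj₁ ∘ label≢) (proj₂ ∘ label≢))
  where
  labels-inj : Injective _≡_ _≡_ (lookup (label x ∷ (labels xs ∷ʳ label y)))
  labels-inj = subst (λ v → Injective _≡_ _≡_ (lookup v)) (cong (label x ∷_) (map-∷ʳ label y xs)) inj
  label≢ : ∀ i → label (lookup xs i) ≢ label x × label (lookup xs i) ≢ label y
  label≢ i = Product.map (_∘ trans (lookup-map i label xs)) (_∘ trans (lookup-map i label xs))
                (inner≢ends (labels xs) labels-inj i)

seamFlip : Fin (suc m) → Token n → Token n
seamFlip p with view p
... | ‵fromℕ     = flipParity
... | ‵inject₁ _ = id

label-seamFlip : ∀ (p : Fin (suc m)) (x : Token n) → label (seamFlip p x) ≡ label x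
label-seamFlip p x with view p
... | ‵fromℕ     = refl
... | ‵inject₁ _ = refl

liftedSwap : Fin (suc m) → Vec (Token n) (suc m) → Vec (Token n) (suc m)
liftedSwap p = swapWith (seamFlip p) p

labels-liftedSwap : ∀ (p : Fin (suc m)) (W : Vec (Token n) (suc m)) →
                    labels (liftedSwap p W) ≡ swapWith id p (labels W)
labels-liftedSwap p W = map-swapWith label (seamFlip p) p W (label-seamFlip p)

twistedInversions-liftedSwap : ∀ (p : Fin (suc m)) (W : Vec (Token n) (suc m)) →
  Injective _≡_ _≡_ (lookup (labels W)) → twistedInversions W ≤ suc (twistedInversions (liftedSwap p W))
twistedInversions-liftedSwap p W inj with view p
... | ‵fromℕ     = twistedInversions-seamSwap W inj
... | ‵inject₁ i = subst (λ V → twistedInversions W ≤ suc (twistedInversions V))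
                     (sym (swapWith-inject₁ i W)) (countPairsᵇ-swapAdjacent twisted i W)

liftedSwaps : List (Fin (suc m)) → Vec (Token n) (suc m) → Vec (Token n) (suc m)
liftedSwaps []       W = W
liftedSwaps (p ∷ ps) W = liftedSwaps ps (liftedSwap p W)

labels-liftedSwaps : ∀ ss (W : Vec (Token (suc m)) (suc m)) →
                     labels (liftedSwaps ss W) ≡ applySwaps ss (labels W)
labels-liftedSwaps []       W = refl
labels-liftedSwaps (p ∷ ps) W =
  trans (labels-liftedSwaps ps (liftedSwap p W)) (cong (applySwaps ps) (labels-liftedSwap p W))

twistedInversions-liftedSwaps : ∀ ss (W : Vec (Token n) (suc m)) → Injective _≡_ _≡_ (lookup (labels W)) →
  twistedInversions W ≤ length ss + twistedInversions (liftedSwaps ss W)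
twistedInversions-liftedSwaps []       W inj = ≤-refl
twistedInversions-liftedSwaps (p ∷ ps) W inj = ≤-trans (twistedInversions-liftedSwap p W inj)
  (s≤s (twistedInversions-liftedSwaps ps (liftedSwap p W) inj′))
  where
  inj′ : Injective _≡_ _≡_ (lookup (labels (liftedSwap p W)))
  inj′ = subst (λ v → Injective _≡_ _≡_ (lookup v)) (sym (labels-liftedSwap p W))
           (swapWith-injective p (labels W) inj)

%-wrap : ∀ {x n} .{{_ : NonZero n}} → n ≤ x → x < n + n → x % n ≡ x ∸ n
%-wrap {x} {n} n≤x x<2n = trans (sym (m≤n⇒[n∸m]%m≡n%m n≤x)) (m<n⇒m%n≡m (m<n+o⇒m∸n<o x n x<2n))

does-<?-rotation : ∀ {c a b n} .{{_ : NonZero n}} → c < n → a < b → b < n →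
  (ca<n? : Dec (c + a < n)) (cb<n? : Dec (c + b < n)) →
  does ((c + b) % n <? (c + a) % n) ≡ does ca<n? xor does cb<n?
does-<?-rotation {c} {a} {b} {n} c<n a<b b<n (yes ca<n) (yes cb<n) =
  trans (cong₂ (λ s t → does (s <? t)) (m<n⇒m%n≡m cb<n) (m<n⇒m%n≡m ca<n))
        (dec-false (c + b <? c + a) (<⇒≯ (+-monoʳ-< c a<b)))
does-<?-rotation {c} {a} {b} {n} c<n a<b b<n (no ca≮n) (yes cb<n) =
  contradiction (<-trans (+-monoʳ-< c a<b) cb<n) ca≮n
does-<?-rotation {c} {a} {b} {n} c<n a<b b<n (yes ca<n) (no cb≮n) =
  trans (cong₂ (λ s t → does (s <? t)) (%-wrap (≮⇒≥ cb≮n) (+-mono-< c<n b<n)) (m<n⇒m%n≡m ca<n))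
        (dec-true (c + b ∸ n <? c + a) wrapped<unwrapped)
  where
  wrapped<unwrapped : c + b ∸ n < c + a
  wrapped<unwrapped = +-cancelʳ-< n (c + b ∸ n) (c + a) (begin-strict
    c + b ∸ n + n  ≡⟨ m∸n+n≡m (≮⇒≥ cb≮n) ⟩
    c + b          <⟨ +-monoʳ-< c b<n ⟩
    c + n          ≤⟨ +-monoˡ-≤ n (m≤m+n c a) ⟩
    c + a + n      ∎)
    where open ≤-Reasoning
does-<?-rotation {c} {a} {b} {n} c<n a<b b<n (no ca≮n) (no cb≮n) =
  trans (cong₂ (λ s t → does (s <? t)) (%-wrap (≮⇒≥ cb≮n) (+-mono-< c<n b<n))
                                       (%-wrap (≮⇒≥ ca≮n) (+-mono-< c<n (<-trans a<b b<n))))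
        (dec-false (c + b ∸ n <? c + a ∸ n) (<⇒≯ (∸-monoˡ-< (+-monoʳ-< c a<b) (≮⇒≥ ca≮n))))

twistedInversions-rotation : ∀ (W : Vec (Token (suc m)) (suc m)) j → labels W ≡ rotate j (trivial (suc m)) →
  4 * twistedInversions W ≤ suc m * suc m
twistedInversions-rotation {m} W j rotated =
  subst₂ _≤_ (cong (4 *_) (sym twistedInversions≡T*F)) (cong (λ s → s * s) (countᵇ-id+not bits))
    (4xy≤[x+y]² (countᵇ id bits) (countᵇ not bits))
  where
  open ≡-Reasoning
  N = suc m
  c = j % N
  unwrapped : Fin N → Bool
  unwrapped p = does (c + toℕ p <? N)
  bit : Fin N → Bool
  bit p = parity (lookup W p) xor unwrapped p
  bits : Vec Bool N
  bits = tabulate bit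
  toℕ-label : ∀ p → toℕ (label (lookup W p)) ≡ (c + toℕ p) % N
  toℕ-label p = begin
    toℕ (label (lookup W p))  ≡⟨ cong toℕ (lookup-map p label W) ⟨
    toℕ (lookup (labels W) p) ≡⟨ cong (λ v → toℕ (lookup v p)) rotated ⟩
    toℕ (lookup (rotate j (trivial N)) p) ≡⟨ toℕ-lookup-rotate-trivial j p ⟩
    (c + toℕ p) % N           ∎
  twisted≡xor : ∀ {p q} → p Fin.< q → twisted (lookup W p) (lookup W q) ≡ lookup bits p xor lookup bits q
  twisted≡xor {p} {q} p<q = begin
    (sp xor sq) xor does (toℕ (label (lookup W q)) <? toℕ (label (lookup W p)))
      ≡⟨ cong ((sp xor sq) xor_) (cong₂ (λ s t → does (s <? t)) (toℕ-label q) (toℕ-label p)) ⟩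
    (sp xor sq) xor does ((c + toℕ q) % N <? (c + toℕ p) % N)
      ≡⟨ cong ((sp xor sq) xor_)
              (does-<?-rotation (m%n<n j N) p<q (toℕ<n q) (c + toℕ p <? N) (c + toℕ q <? N)) ⟩
    (sp xor sq) xor (unwrapped p xor unwrapped q)
      ≡⟨ xor-interchange sp sq (unwrapped p) (unwrapped q) ⟩
    bit p xor bit q
      ≡⟨ cong₂ _xor_ (lookup∘tabulate bit p) (lookup∘tabulate bit q) ⟨
    lookup bits p xor lookup bits q ∎
    where
    sp = parity (lookup W p)
    sq = parity (lookup W q)
  twistedInversions≡T*F : twistedInversions W ≡ countᵇ id bits * countᵇ not bits
  twistedInversions≡T*F = trans (countPairsᵇ-cong W bits twisted≡xor) (countPairsᵇ-xor bits)

reversal : ∀ n → Labeling n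
reversal n = tabulate opposite

opposite-injective : Injective _≡_ _≡_ (opposite {n})
opposite-injective {x = i} {j} eq =
  trans (sym (opposite-involutive i)) (trans (cong opposite eq) (opposite-involutive j))

opposite-< : ∀ {i j : Fin n} → i Fin.< j → opposite j Fin.< opposite i
opposite-< {i = i} {j} i<j =
  subst₂ _<_ (sym (opposite-prop j)) (sym (opposite-prop i)) (∸-monoʳ-< (s<s i<j) (toℕ<n j))

reversal-injective : Injective _≡_ _≡_ (lookup (reversal n))
reversal-injective {x = p} {q} eq =
  opposite-injective (trans (sym (lookup∘tabulate opposite p)) (trans eq (lookup∘tabulate opposite q)))

reversal-bijective : IsBijective (reversal n)
reversal-bijective =
  (λ _ _ → reversal-injective) ,
  (λ j → opposite j , trans (lookup∘tabulate opposite (opposite j)) (opposite-involutive j))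

untwisted : Vec (Fin n) k → Vec (Token n) k
untwisted = map (_, false)

labels-untwisted : (v : Vec (Fin n) k) → labels (untwisted v) ≡ v
labels-untwisted v = trans (sym (map-∘ label (_, false) v)) (map-id v)

twistedInversions-reversal : ∀ n → 2 * twistedInversions (untwisted (reversal n)) + n ≡ n * n
twistedInversions-reversal n =
  trans (cong (λ t → 2 * t + n) (countPairsᵇ-cong W W inverted)) (countPairsᵇ-true W)
  where
  W = untwisted (reversal n)
  lookup-W : ∀ p → lookup W p ≡ (opposite p , false)
  lookup-W p = trans (lookup-map p (_, false) (reversal n)) (cong (_, false) (lookup∘tabulate opposite p))
  inverted : ∀ {p q} → p Fin.< q → twisted (lookup W p) (lookup W q) ≡ true
  inverted {p} {q} p<q = trans (cong₂ twisted (lookup-W p) (lookup-W q))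
    (dec-true (toℕ (opposite q) <? toℕ (opposite p)) (opposite-< p<q))

-- 4A = 2n² − 2n, so A ≤ L + B with 4B ≤ n² gives n² ≤ 4L + 2n, i.e. m² ≤ 4L + 1.
quarter-square-bound : ∀ m {A L B} → 2 * A + suc m ≡ suc m * suc m → A ≤ L + B → 4 * B ≤ suc m * suc m →
                       m * m / 4 ≤ L
quarter-square-bound m {A} {L} {B} 2A+n≡n² A≤L+B 4B≤n² =
  m<1+n⇒m≤n (m<n*o⇒m/o<n (≤-<-trans m*m≤4L+1 4L+1<[1+L]*4))
  where
  open ≤-Reasoning
  N = suc m
  m*m≤4L+1 : m * m ≤ 4 * L + 1
  m*m≤4L+1 = +-cancelʳ-≤ (2 * m + 1 + N * N) (m * m) (4 * L + 1) (begin
    m * m + (2 * m + 1 + N * N)      ≡⟨ twice-square m ⟩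
    2 * (N * N)                      ≡⟨ cong (2 *_) 2A+n≡n² ⟨
    2 * (2 * A + N)                  ≡⟨ expand A N ⟩
    4 * A + 2 * N                    ≤⟨ +-monoˡ-≤ (2 * N) (*-monoʳ-≤ 4 A≤L+B) ⟩
    4 * (L + B) + 2 * N              ≡⟨ cong (_+ 2 * N) (*-distribˡ-+ 4 L B) ⟩
    4 * L + 4 * B + 2 * N            ≤⟨ +-monoˡ-≤ (2 * N) (+-monoʳ-≤ (4 * L) 4B≤n²) ⟩
    4 * L + N * N + 2 * N            ≡⟨ regroup L m ⟩
    4 * L + 1 + (2 * m + 1 + N * N)  ∎)
    where
    twice-square : ∀ m → m * m + (2 * m + 1 + suc m * suc m) ≡ 2 * (suc m * suc m)
    twice-square = solve-∀
    expand : ∀ A N → 2 * (2 * A + N) ≡ 4 * A + 2 * N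
    expand = solve-∀
    regroup : ∀ L m → 4 * L + suc m * suc m + 2 * suc m ≡ 4 * L + 1 + (2 * m + 1 + suc m * suc m)
    regroup = solve-∀
  4L+1<[1+L]*4 : 4 * L + 1 < suc L * 4
  4L+1<[1+L]*4 = subst (4 * L + 1 <_) (plus-three L) (m<m+n (4 * L + 1) z<s)
    where
    plus-three : ∀ L → 4 * L + 1 + 3 ≡ suc L * 4
    plus-three = solve-∀

theorem2p2 : ∀ (m : ℕ) → ∃ λ (π : Labeling (suc m)) → IsBijective π ×
               (∀ (ss : List (Fin (suc m))) → IsTrivialCyclic (applySwaps ss π) →
                 (m * m) / 4 ≤ length ss)
theorem2p2 m = reversal N , reversal-bijective , bound
  where
  N = suc m
  W = untwisted (reversal N)
  labels-W-injective : Injective _≡_ _≡_ (lookup (labels W))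
  labels-W-injective = subst (λ v → Injective _≡_ _≡_ (lookup v)) (sym (labels-untwisted (reversal N)))
                         reversal-injective
  bound : ∀ ss → IsTrivialCyclic (applySwaps ss (reversal N)) → (m * m) / 4 ≤ length ss
  bound ss (j , rotated) = quarter-square-bound m
    (twistedInversions-reversal N)
    (twistedInversions-liftedSwaps ss W labels-W-injective)
    (twistedInversions-rotation (liftedSwaps ss W) j (begin
      labels (liftedSwaps ss W)   ≡⟨ labels-liftedSwaps ss W ⟩
      applySwaps ss (labels W)    ≡⟨ cong (applySwaps ss) (labels-untwisted (reversal N)) ⟩
      applySwaps ss (reversal N)  ≡⟨ rotated ⟩
      rotate j (trivial N)        ∎))
    where open ≡-Reasoning
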